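{- Let $\mathbf a=(a_1,\dots,a_{10})\in\mathbb N^{10}$ and $\beta=(\beta_1,\dots,\beta_{10})\in\mathbb Z^{10}$ with $B_{\mathbf a}(\alpha,\beta)=1$. Suppose $j_1,\dots,j_l$ are distinct indices in $\{1,\dots,10\}$ (in any order) with $\beta_{j_1}=\beta_{j_2}=\cdots=\beta_{j_l}$. Then for every prime $p$, $L_{\mathbf a,\beta}\otimes\mathbb Z_p$ contains a $\mathbb Z_p$-sublattice isometric to $\langle b_1\rangle\perp\cdots\perp\langle b_{l-1}\rangle$, where $$b_h=a_{j_{h+1}}\Big(\sum_{k=1}^{h}a_{j_k}\Big)\Big(\sum_{k=1}^{h+1}a_{j_k}\Big),\qquad 1\le h\le l-1.$$
   Context: $Q_{\mathbf a}(\mathbf x)=\sum a_ix_i^2$, $B_{\mathbf a}(\mathbf x,\mathbf y)=\sum a_ix_iy_i$, $\alpha=(1,\dots,1)\in\mathbb Z^{10}$, $L_{\mathbf a,\beta}=\{\mathbf x\in\mathbb Z^{10}: B_{\mathbf a}(\alpha,\mathbf x)=B_{\mathbf a}(\beta,\mathbf x)=0\}$ with form $Q_{\mathbf a}$. $\langle c_1\rangle\perp\cdots\perp\langle c_k\rangle$ denotes the diagonal lattice with form $c_1y_1^2+\cdots+c_ky_k^2$. -}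

module Defs where

open import Data.Nat as ℕ using (ℕ; zero; suc; _^_)
open import Data.Fin using (Fin; zero; suc; toℕ)
open import Data.Integer as ℤ using (ℤ; +_; _-_; _+_; _*_; 0ℤ)
open import Data.Integer.Divisibility.Signed
  using (_∣_; ∣-refl; ∣m∣n⇒∣m+n; ∣n⇒∣m*n; ∣m⇒∣m*n; ∣m∣n⇒∣m-n)
open import Data.Integer.Tactic.RingSolver using (solve-∀)
open import Relation.Binary.PropositionalEquality using (_≡_; subst; sym)
open import Relation.Nullary using (¬_)

-- The ring ℤ_p of p-adic integers, realised as the inverse limit of the
-- rings ℤ/p^n ℤ: a p-adic integer is a sequence (x n) of integers with
-- x (n+1) ≡ x n (mod p^n); the term x n represents the residue mod p^n.

record ℤₚ (p : ℕ) : Set where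
  constructor padic
  field
    digits : ℕ → ℤ
    compat : ∀ n → (+ (p ^ n)) ∣ (digits (suc n) - digits n)
open ℤₚ public

private
  zId : ∀ z → 0ℤ * z ≡ z - z
  zId = solve-∀

  0∣ : ∀ {k : ℤ} (z : ℤ) → k ∣ (z - z)
  0∣ {k} z = subst (k ∣_) (zId z) (∣n⇒∣m*n 0ℤ (∣-refl {k}) |> λ d → subst (k ∣_) (zId2 k z) d)
    where
    _|>_ : ∀ {A B : Set} → A → (A → B) → B
    x |> f = f x
    zId2 : ∀ k z → 0ℤ * k ≡ 0ℤ * z
    zId2 = solve-∀

  sumId : ∀ a b c d → (a + b) - (c + d) ≡ (a - c) + (b - d)
  sumId = solve-∀

  mulId : ∀ a b c d → a * b - c * d ≡ a * (b - d) + (a - c) * d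
  mulId = solve-∀

module _ {p : ℕ} where

  infix 4 _≈ₚ_
  _≈ₚ_ : ℤₚ p → ℤₚ p → Set
  x ≈ₚ y = ∀ n → (+ (p ^ n)) ∣ (digits x n - digits y n)

  infixl 6 _+ₚ_
  _+ₚ_ : ℤₚ p → ℤₚ p → ℤₚ p
  x +ₚ y = padic (λ n → digits x n + digits y n)
    (λ n → subst (+ (p ^ n) ∣_)
      (sym (sumId (digits x (suc n)) (digits y (suc n)) (digits x n) (digits y n)))
      (∣m∣n⇒∣m+n (compat x n) (compat y n)))

  infixl 7 _*ₚ_
  _*ₚ_ : ℤₚ p → ℤₚ p → ℤₚ p
  x *ₚ y = padic (λ n → digits x n * digits y n)
    (λ n → subst (+ (p ^ n) ∣_)
      (sym (mulId (digits x (suc n)) (digits y (suc n)) (digits x n) (digits y n)))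
      (∣m∣n⇒∣m+n (∣n⇒∣m*n (digits x (suc n)) (compat y n))
                 (∣m⇒∣m*n (digits y n) (compat x n))))

ι : (p : ℕ) → ℤ → ℤₚ p
ι p z = padic (λ _ → z) (λ n → 0∣ z)

0ₚ : (p : ℕ) → ℤₚ p
0ₚ p = ι p 0ℤ

Σₚ : ∀ {p n} → (Fin n → ℤₚ p) → ℤₚ p
Σₚ {p} {zero} f = 0ₚ p
Σₚ {p} {suc n} f = f zero +ₚ Σₚ (λ i → f (suc i))

Σℤ : ∀ {n} → (Fin n → ℤ) → ℤ
Σℤ {zero} f = 0ℤ
Σℤ {suc n} f = f zero + Σℤ (λ i → f (suc i))

-- Prefix sum: prefixSum f k = f 0 + ... + f (k-1)  (truncated at n).
prefixSum : ∀ {n} → (Fin n → ℕ) → ℕ → ℕ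
prefixSum {zero} f k = 0
prefixSum {suc n} f zero = 0
prefixSum {suc n} f (suc k) = f zero ℕ.+ prefixSum (λ i → f (suc i)) k

Bₚ : ∀ {p n} → (Fin n → ℤ) → (Fin n → ℤₚ p) → (Fin n → ℤₚ p) → ℤₚ p
Bₚ {p} a x y = Σₚ (λ i → ι p (a i) *ₚ x i *ₚ y i)

Bℤ : ∀ {n} → (Fin n → ℤ) → (Fin n → ℤ) → (Fin n → ℤ) → ℤ
Bℤ a x y = Σℤ (λ i → a i * x i * y i)

α : ∀ {n} → Fin n → ℤ
α _ = + 1

-- Membership of x ∈ ℤ_p^10 in L_{a,β} ⊗ ℤ_p
-- (= kernel of x ↦ (B_a(α,x), B_a(β,x)) on ℤ_p^10, by flatness of ℤ_p).
record InLₚ {p : ℕ} (a : Fin 10 → ℤ) (β : Fin 10 → ℤ) (x : Fin 10 → ℤₚ p) : Set where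
  field
    orthα : Bₚ a (λ i → ι p (α i)) x ≈ₚ 0ₚ p
    orthβ : Bₚ a (λ i → ι p (β i)) x ≈ₚ 0ₚ p

-- L_{a,β} ⊗ ℤ_p contains a ℤ_p-sublattice isometric to ⟨b_0⟩ ⊥ ⋯ ⊥ ⟨b_{m-1}⟩:
-- there are vectors v_0,…,v_{m-1} in L_{a,β} ⊗ ℤ_p, linearly independent over
-- ℤ_p (so they form a basis of the sublattice they span), whose Gram matrix
-- w.r.t. B_a is diag(b_0,…,b_{m-1}).
record DiagSublattice (p : ℕ) (a : Fin 10 → ℤ) (β : Fin 10 → ℤ) (m : ℕ) (b : Fin m → ℤ) : Set where
  field
    v       : Fin m → Fin 10 → ℤₚ p
    inL     : ∀ h → InLₚ a β (v h)
    linIndep : (c : Fin m → ℤₚ p) →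
               (∀ i → Σₚ (λ h → c h *ₚ v h i) ≈ₚ 0ₚ p) →
               ∀ h → c h ≈ₚ 0ₚ p
    gramDiag : ∀ h → Bₚ a (v h) (v h) ≈ₚ ι p (b h)
    gramOff  : ∀ h k → ¬ (h ≡ k) → Bₚ a (v h) (v k) ≈ₚ 0ₚ p

{-# OPTIONS --safe #-}
-- Write A k = a (j k) and S h = A 0 + ⋯ + A h.  The vector
--   u h = - A (h+1) (e (j 0) + ⋯ + e (j h)) + S h e (j (h+1))
-- is orthogonal to α, hence also to β, which is constant on the coordinates j k.
-- For h < h′ the vector u h′ is constant on the support of u h, so the u h are
-- pairwise orthogonal, and B (u h) (u h) = A (h+1) S h (S h + A (h+1)) = b h.
-- When S h = 0, u h may vanish; then e (j h), which lies in the radical since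
-- A h = 0, is used instead.
-- The vectors are triangular with nonzero integer pivots, and a nonzero integer
-- is not a zero divisor in ℤ_p, so they are independent over ℤ_p.
module Submission where

open import Defs
open import Data.Nat.Base as ℕ using (ℕ; zero; suc; z≤n; s≤s)
import Data.Nat.Properties as ℕ
open import Data.Fin.Base using (Fin; zero; suc; toℕ; inject₁)
open import Data.Fin.Properties using (_≟_; <-cmp; suc-injective; toℕ-inject₁)
open import Data.Integer.Base using (ℤ; +_; -_; 0ℤ; 1ℤ)
import Data.Integer.Properties as ℤ
open import Data.Integer.Tactic.RingSolver using (solve-∀)
open import Algebra.Properties.Semiring.Sum ℤ.+-*-semiring
  using (sum; sum-cong-≗; sum-replicate-zero; ∑-distrib-+; ∑-comm; *-distribˡ-sum; *-distribʳ-sum)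
open import Data.Sum.Base using (_⊎_; inj₁; inj₂)
open import Function.Base using (_∘_)
open import Function.Definitions using (Injective)
open import Relation.Binary.Definitions using (Tri; tri<; tri≈; tri>)
open import Relation.Binary.PropositionalEquality
open import Relation.Nullary using (¬_; yes; no; contradiction)

module PrimePowerDivisibility where
  open import Data.Nat.Base
  open import Data.Nat.Properties
  open import Data.Nat.Divisibility
  open import Data.Nat.Induction using (<-wellFounded)
  open import Data.Nat.Primality using (Prime; euclidsLemma; prime⇒nonZero; prime⇒nonTrivial)
  open import Data.Nat.Solver using (module +-*-Solver)
  open import Data.Sum.Base using (fromInj₂)
  open import Induction.WellFounded using (Acc; acc)
  open +-*-Solver using (solve; _:=_; _:*_)

  ^-monoʳ-∣ : ∀ p {m n} → m ≤ n → p ^ m ∣ p ^ n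
  ^-monoʳ-∣ p {m} {n} m≤n =
    subst (λ k → p ^ m ∣ p ^ k) (m+[n∸m]≡n m≤n)
      (subst (p ^ m ∣_) (sym (^-distribˡ-+-* p m (n ∸ m))) (m∣m*n (p ^ (n ∸ m))))

  p^n∣m*o⇒p^n∣o : ∀ {p m o} → Prime p → ¬ p ∣ m → ∀ n → p ^ n ∣ m * o → p ^ n ∣ o
  p^n∣m*o⇒p^n∣o _ _ zero _ = 1∣ _
  p^n∣m*o⇒p^n∣o {p} {m} pp p∤m (suc n) p^[1+n]∣m*o
    with p^n∣m*o⇒p^n∣o pp p∤m n (∣-trans (^-monoʳ-∣ p (n≤1+n n)) p^[1+n]∣m*o)
  ... | divides q refl = *-monoˡ-∣ (p ^ n) p∣q
    where
    instance _ = m^n≢0 p n {{prime⇒nonZero pp}}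
    p∣m*q : p ∣ m * q
    p∣m*q = *-cancelʳ-∣ (p ^ n) (subst (p * p ^ n ∣_) (sym (*-assoc m q (p ^ n))) p^[1+n]∣m*o)
    p∣q : p ∣ q
    p∣q = fromInj₂ (λ p∣m → contradiction p∣m p∤m) (euclidsLemma m q pp p∣m*q)

  -- The exponent m + n suffices because the p-part of m is at most p ^ m.
  p^[m+n]∣m*o⇒p^n∣o : ∀ {p o} → Prime p → ∀ m .{{_ : NonZero m}} n →
                      p ^ (m + n) ∣ m * o → p ^ n ∣ o
  p^[m+n]∣m*o⇒p^n∣o {p} {o} pp m n = go m (<-wellFounded m)
    where
    instance _ = prime⇒nonZero pp
    instance _ = prime⇒nonTrivial pp
    go : ∀ m .{{_ : NonZero m}} → Acc _<_ m → p ^ (m + n) ∣ m * o → p ^ n ∣ o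
    go m _ dvd with p ∣? m
    ... | no p∤m = p^n∣m*o⇒p^n∣o pp p∤m n (∣-trans (^-monoʳ-∣ p (m≤n+m n m)) dvd)
    go .(q * p) (acc rec) dvd | yes (divides q refl) = go q (rec q<q*p) (*-cancelˡ-∣ p dvd′)
      where
      instance _ = m*n≢0⇒m≢0 q
      q<q*p : q < q * p
      q<q*p = m<m*n q p (nonTrivial⇒n>1 p)
      dvd′ : p * p ^ (q + n) ∣ p * (q * o)
      dvd′ = ∣-trans (^-monoʳ-∣ p (+-monoˡ-≤ n q<q*p))
               (subst (p ^ (q * p + n) ∣_) (solve 3 (λ q p o → q :* p :* o := p :* (q :* o)) refl q p o) dvd)

module FiniteSums where
  open import Data.Integer.Base using (_+_; _*_)
  open import Data.Integer.Divisibility.Signed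
    using (_∣_; divides; ∣m∣n⇒∣m+n; ∣m+n∣m⇒∣n; ∣m+n∣n⇒∣m)

  Σℤ≡sum : ∀ {n} (f : Fin n → ℤ) → Σℤ f ≡ sum f
  Σℤ≡sum {zero} f = refl
  Σℤ≡sum {suc n} f = cong (λ s → f zero + s) (Σℤ≡sum (f ∘ suc))

  ∣-sum : ∀ {n q} {f : Fin n → ℤ} → (∀ i → q ∣ f i) → q ∣ sum f
  ∣-sum {zero} _ = divides 0ℤ refl
  ∣-sum {suc n} q∣f = ∣m∣n⇒∣m+n (q∣f zero) (∣-sum (q∣f ∘ suc))

  ∣sum⇒∣term : ∀ {n q} (f : Fin n → ℤ) h →
               q ∣ sum f → (∀ k → k ≢ h → q ∣ f k) → q ∣ f h
  ∣sum⇒∣term f zero q∣Σ q∣others =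
    ∣m+n∣n⇒∣m q∣Σ (∣-sum (λ i → q∣others (suc i) (λ ())))
  ∣sum⇒∣term f (suc h) q∣Σ q∣others =
    ∣sum⇒∣term (f ∘ suc) h (∣m+n∣m⇒∣n q∣Σ (q∣others zero (λ ())))
      (λ k k≢h → q∣others (suc k) (k≢h ∘ suc-injective))

  δ : ∀ {n} → Fin n → Fin n → ℤ
  δ zero    zero    = 1ℤ
  δ zero    (suc _) = 0ℤ
  δ (suc _) zero    = 0ℤ
  δ (suc i) (suc k) = δ i k

  δ-refl : ∀ {n} (i : Fin n) → δ i i ≡ 1ℤ
  δ-refl zero = refl
  δ-refl (suc i) = δ-refl i

  δ-≢ : ∀ {n} {i k : Fin n} → i ≢ k → δ i k ≡ 0ℤ
  δ-≢ {i = zero}  {zero}  i≢k = contradiction refl i≢k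
  δ-≢ {i = zero}  {suc k} _   = refl
  δ-≢ {i = suc i} {zero}  _   = refl
  δ-≢ {i = suc i} {suc k} i≢k = δ-≢ (i≢k ∘ cong suc)

  δ-sym : ∀ {n} (i k : Fin n) → δ i k ≡ δ k i
  δ-sym zero    zero    = refl
  δ-sym zero    (suc k) = refl
  δ-sym (suc i) zero    = refl
  δ-sym (suc i) (suc k) = δ-sym i k

  sum-δ : ∀ {n} (k : Fin n) (f : Fin n → ℤ) → sum (λ i → δ k i * f i) ≡ f k
  sum-δ {suc n} zero f =
    trans (cong₂ _+_ (ℤ.*-identityˡ (f zero)) (sum-replicate-zero n)) (ℤ.+-identityʳ (f zero))
  sum-δ {suc n} (suc k) f = trans (ℤ.+-identityˡ _) (sum-δ k (f ∘ suc))

  Bℤ≡sum : ∀ {n} (a x y : Fin n → ℤ) → Bℤ a x y ≡ sum (λ i → a i * x i * y i)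
  Bℤ≡sum a x y = Σℤ≡sum (λ i → a i * x i * y i)

module PAdic where
  open FiniteSums
  open PrimePowerDivisibility
  open import Data.Nat.Base using (_^_)
  open import Data.Nat.Divisibility using () renaming (_∣_ to _∣ℕ_)
  open import Data.Nat.Primality using (Prime)
  open import Data.Fin.Base using (_<_; _>_)
  open import Data.Fin.Induction using (>-wellFounded)
  open import Data.Integer.Base using (_+_; _*_; _-_; ∣_∣)
  open import Data.Integer.Divisibility.Signed
    using (_∣_; divides; ∣ᵤ⇒∣; ∣⇒∣ᵤ; ∣-trans; ∣m∣n⇒∣m+n; ∣m∣n⇒∣m-n; ∣m⇒∣m*n; ∣n⇒∣m*n)
  open import Induction.WellFounded using (module All)
  open import Level using (0ℓ)

  module _ {p : ℕ} where

    ∣0 : ∀ {q} → q ∣ 0ℤ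
    ∣0 = divides 0ℤ refl

    ≈0ₚ⇒∣ : ∀ (x : ℤₚ p) → x ≈ₚ 0ₚ p → ∀ n → + (p ^ n) ∣ digits x n
    ≈0ₚ⇒∣ x x≈0 n = subst (_ ∣_) (ℤ.+-identityʳ _) (x≈0 n)

    ∣⇒≈0ₚ : ∀ (x : ℤₚ p) → (∀ n → + (p ^ n) ∣ digits x n) → x ≈ₚ 0ₚ p
    ∣⇒≈0ₚ x p^n∣x n = subst (_ ∣_) (sym (ℤ.+-identityʳ _)) (p^n∣x n)

    ≈ₚ-ι : ∀ (x : ℤₚ p) {z} → (∀ n → digits x n ≡ z) → x ≈ₚ ι p z
    ≈ₚ-ι x {z} x≡z n =
      subst (λ t → _ ∣ t - z) (sym (x≡z n)) (subst (_ ∣_) (sym (ℤ.+-inverseʳ z)) ∣0)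

    digits-Σₚ : ∀ {n} (f : Fin n → ℤₚ p) k → digits (Σₚ f) k ≡ sum (λ i → digits (f i) k)
    digits-Σₚ {zero} f k = refl
    digits-Σₚ {suc n} f k = cong (λ s → digits (f zero) k + s) (digits-Σₚ (f ∘ suc) k)

    Bₚ-ι : ∀ {n} (a x y : Fin n → ℤ) {z} → Bℤ a x y ≡ z →
           Bₚ a (λ i → ι p (x i)) (λ i → ι p (y i)) ≈ₚ ι p z
    Bₚ-ι a x y B≡z = ≈ₚ-ι (Bₚ a (λ i → ι p (x i)) (λ i → ι p (y i)))
      (λ k → trans (digits-Σₚ (λ i → ι p (a i) *ₚ ι p (x i) *ₚ ι p (y i)) k)
                   (trans (sym (Bℤ≡sum a x y)) B≡z))

    digits-≡-mod : ∀ (x : ℤₚ p) k n → + (p ^ n) ∣ digits x (k ℕ.+ n) - digits x n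
    digits-≡-mod x zero n = subst (_ ∣_) (sym (ℤ.+-inverseʳ (digits x n))) ∣0
    digits-≡-mod x (suc k) n =
      subst (_ ∣_) (telescope (digits x (suc k ℕ.+ n)) (digits x (k ℕ.+ n)) (digits x n))
        (∣m∣n⇒∣m+n (∣-trans (∣ᵤ⇒∣ (^-monoʳ-∣ p (ℕ.m≤n+m n k))) (compat x (k ℕ.+ n)))
                   (digits-≡-mod x k n))
      where
      telescope : ∀ a b c → (a - b) + (b - c) ≡ a - c
      telescope = solve-∀

    *ι-cancelʳ : Prime p → ∀ d → d ≢ 0ℤ → (c : ℤₚ p) → c *ₚ ι p d ≈ₚ 0ₚ p → c ≈ₚ 0ₚ p
    *ι-cancelʳ pp d d≢0 c cd≈0 = ∣⇒≈0ₚ c p^n∣cₙ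
      where
      instance _ = ℕ.≢-nonZero (d≢0 ∘ ℤ.∣i∣≡0⇒i≡0)
      p^n∣cₙ : ∀ n → + (p ^ n) ∣ digits c n
      p^n∣cₙ n = subst (_ ∣_) (cancel (digits c N) (digits c n))
                   (∣m∣n⇒∣m-n p^n∣c_N (digits-≡-mod c ∣ d ∣ n))
        where
        N = ∣ d ∣ ℕ.+ n
        p^n∣c_N : + (p ^ n) ∣ digits c N
        p^n∣c_N = ∣ᵤ⇒∣ (p^[m+n]∣m*o⇒p^n∣o pp ∣ d ∣ n
                    (subst (p ^ N ∣ℕ_) (trans (ℤ.abs-* (digits c N) d) (ℕ.*-comm _ ∣ d ∣))
                      (∣⇒∣ᵤ (≈0ₚ⇒∣ (c *ₚ ι p d) cd≈0 N))))
        cancel : ∀ a b → a - (a - b) ≡ b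
        cancel = solve-∀

    triangular⇒independent : Prime p → ∀ {m N} (v : Fin m → Fin N → ℤ) (pivot : Fin m → Fin N) →
      (∀ h → v h (pivot h) ≢ 0ℤ) → (∀ {k h} → k < h → v k (pivot h) ≡ 0ℤ) →
      (c : Fin m → ℤₚ p) → (∀ i → Σₚ (λ h → c h *ₚ ι p (v h i)) ≈ₚ 0ₚ p) →
      ∀ h → c h ≈ₚ 0ₚ p
    -- Descending induction on h: modulo p ^ n, only the term of c h survives in coordinate pivot h.
    triangular⇒independent pp {m} v pivot v-pivot≢0 v-below-pivot c Σcv≈0 =
      All.wfRec >-wellFounded 0ℓ (λ h → c h ≈ₚ 0ₚ p) step
      where
      step : ∀ h → (∀ {k} → k > h → c k ≈ₚ 0ₚ p) → c h ≈ₚ 0ₚ p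
      step h later≈0 = *ι-cancelʳ pp (v h (pivot h)) (v-pivot≢0 h) (c h) (∣⇒≈0ₚ (cv h) p^n∣term-h)
        where
        cv : Fin m → ℤₚ p
        cv k = c k *ₚ ι p (v k (pivot h))
        term : ℕ → Fin m → ℤ
        term n k = digits (cv k) n
        p^n∣term-h : ∀ n → + (p ^ n) ∣ term n h
        p^n∣term-h n = ∣sum⇒∣term (term n) h
          (subst (_ ∣_) (digits-Σₚ cv n) (≈0ₚ⇒∣ (Σₚ cv) (Σcv≈0 (pivot h)) n)) other-terms
          where
          other-terms : ∀ k → k ≢ h → + (p ^ n) ∣ term n k
          other-terms k k≢h = by-trichotomy (<-cmp k h)
            where
            by-trichotomy : Tri (k < h) (k ≡ h) (k > h) → + (p ^ n) ∣ term n k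
            by-trichotomy (tri< k<h _ _) = subst (λ t → _ ∣ digits (c k) n * t) (sym (v-below-pivot k<h))
                                             (∣n⇒∣m*n (digits (c k) n) ∣0)
            by-trichotomy (tri≈ _ k≡h _) = contradiction k≡h k≢h
            by-trichotomy (tri> _ _ k>h) = ∣m⇒∣m*n _ (≈0ₚ⇒∣ (c k) (later≈0 k>h) n)

module DiagonalForms where
  open FiniteSums
  open import Data.Integer.Base using (_+_; _*_)

  module _ {n : ℕ} (w : Fin n → ℤ) where

    Bℤ-pointwise : ∀ {x y x′ y′ : Fin n → ℤ} → (∀ i → w i * x i * y i ≡ w i * x′ i * y′ i) →
                   Bℤ w x y ≡ Bℤ w x′ y′
    Bℤ-pointwise {x} {y} {x′} {y′} eq =
      trans (Bℤ≡sum w x y) (trans (sum-cong-≗ eq) (sym (Bℤ≡sum w x′ y′)))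

    Bℤ-sym : ∀ x y → Bℤ w x y ≡ Bℤ w y x
    Bℤ-sym x y = Bℤ-pointwise (λ i → swap (w i) (x i) (y i))
      where
      swap : ∀ a b c → a * b * c ≡ a * c * b
      swap = solve-∀

    Bℤ-congʳ : ∀ x {y y′} → (∀ i → y i ≡ y′ i) → Bℤ w x y ≡ Bℤ w x y′
    Bℤ-congʳ x y≗y′ = Bℤ-pointwise (λ i → cong (w i * x i *_) (y≗y′ i))

    Bℤ-δˡ : ∀ k y → Bℤ w (δ k) y ≡ w k * y k
    Bℤ-δˡ k y = begin
      Bℤ w (δ k) y                        ≡⟨ Bℤ≡sum w (δ k) y ⟩
      sum (λ i → w i * δ k i * y i)       ≡⟨ sum-cong-≗ (λ i → shuffle (w i) (δ k i) (y i)) ⟩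
      sum (λ i → δ k i * (w i * y i))     ≡⟨ sum-δ k (λ i → w i * y i) ⟩
      w k * y k                           ∎
      where
      open ≡-Reasoning
      shuffle : ∀ a d b → a * d * b ≡ d * (a * b)
      shuffle = solve-∀

    Bℤ-linearˡ : ∀ r s x x′ y →
      Bℤ w (λ i → r * x i + s * x′ i) y ≡ r * Bℤ w x y + s * Bℤ w x′ y
    Bℤ-linearˡ r s x x′ y = begin
      Bℤ w (λ i → r * x i + s * x′ i) y
        ≡⟨ Bℤ≡sum w (λ i → r * x i + s * x′ i) y ⟩
      sum (λ i → w i * (r * x i + s * x′ i) * y i)
        ≡⟨ sum-cong-≗ (λ i → expand (w i) r (x i) s (x′ i) (y i)) ⟩
      sum (λ i → r * (w i * x i * y i) + s * (w i * x′ i * y i))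
        ≡⟨ ∑-distrib-+ (λ i → r * (w i * x i * y i)) (λ i → s * (w i * x′ i * y i)) ⟩
      sum (λ i → r * (w i * x i * y i)) + sum (λ i → s * (w i * x′ i * y i))
        ≡⟨ sym (cong₂ _+_ (*-distribˡ-sum r (λ i → w i * x i * y i))
                          (*-distribˡ-sum s (λ i → w i * x′ i * y i))) ⟩
      r * sum (λ i → w i * x i * y i) + s * sum (λ i → w i * x′ i * y i)
        ≡⟨ sym (cong₂ (λ b b′ → r * b + s * b′) (Bℤ≡sum w x y) (Bℤ≡sum w x′ y)) ⟩
      r * Bℤ w x y + s * Bℤ w x′ y
        ∎
      where
      open ≡-Reasoning
      expand : ∀ a r b s b′ c → a * (r * b + s * b′) * c ≡ r * (a * b * c) + s * (a * b′ * c)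
      expand = solve-∀

    Bℤ-constOnSupport : ∀ x y r → (∀ i → x i ≡ 0ℤ ⊎ y i ≡ r) → Bℤ w x y ≡ r * Bℤ w x α
    Bℤ-constOnSupport x y r x≡0⊎y≡r = begin
      Bℤ w x y                              ≡⟨ Bℤ≡sum w x y ⟩
      sum (λ i → w i * x i * y i)           ≡⟨ sum-cong-≗ pointwise ⟩
      sum (λ i → r * (w i * x i * + 1))     ≡⟨ sym (*-distribˡ-sum r (λ i → w i * x i * + 1)) ⟩
      r * sum (λ i → w i * x i * + 1)       ≡⟨ cong (r *_) (sym (Bℤ≡sum w x α)) ⟩
      r * Bℤ w x α                          ∎
      where
      open ≡-Reasoning
      on-zero : ∀ a b r → a * 0ℤ * b ≡ r * (a * 0ℤ * + 1)
      on-zero = solve-∀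
      on-const : ∀ a b r → a * b * r ≡ r * (a * b * + 1)
      on-const = solve-∀
      pointwise : ∀ i → w i * x i * y i ≡ r * (w i * x i * + 1)
      pointwise i with x≡0⊎y≡r i
      ... | inj₁ x≡0 rewrite x≡0 = on-zero (w i) (y i) r
      ... | inj₂ y≡r rewrite y≡r = on-const (w i) (x i) r

  pushforward : ∀ {n N} → (Fin n → Fin N) → (Fin n → ℤ) → Fin N → ℤ
  pushforward j x i = sum (λ k → x k * δ (j k) i)

  module _ {n N} (j : Fin n → Fin N) where

    δ-∘-injective : Injective _≡_ _≡_ j → ∀ k k′ → δ (j k) (j k′) ≡ δ k k′
    δ-∘-injective j-inj k k′ with k ≟ k′
    ... | yes refl = trans (δ-refl (j k)) (sym (δ-refl k))
    ... | no k≢k′ = trans (δ-≢ (k≢k′ ∘ j-inj)) (sym (δ-≢ k≢k′))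

    pushforward-∘ : Injective _≡_ _≡_ j → ∀ x k → pushforward j x (j k) ≡ x k
    pushforward-∘ j-inj x k = begin
      sum (λ k′ → x k′ * δ (j k′) (j k))
        ≡⟨ sum-cong-≗ (λ k′ → cong (x k′ *_) (trans (δ-∘-injective j-inj k′ k) (δ-sym k′ k))) ⟩
      sum (λ k′ → x k′ * δ k k′)
        ≡⟨ sum-cong-≗ (λ k′ → ℤ.*-comm (x k′) (δ k k′)) ⟩
      sum (λ k′ → δ k k′ * x k′)
        ≡⟨ sum-δ k x ⟩
      x k
        ∎
      where open ≡-Reasoning

    Bℤ-pushforwardˡ : ∀ w x y → Bℤ w (pushforward j x) y ≡ Bℤ (w ∘ j) x (y ∘ j)
    Bℤ-pushforwardˡ w x y = begin
      Bℤ w (pushforward j x) y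
        ≡⟨ Bℤ≡sum w (pushforward j x) y ⟩
      sum (λ i → w i * sum (λ k → x k * δ (j k) i) * y i)
        ≡⟨ sum-cong-≗ (λ i → distrib (w i) (λ k → x k * δ (j k) i) (y i)) ⟩
      sum (λ i → sum (λ k → w i * (x k * δ (j k) i) * y i))
        ≡⟨ ∑-comm (λ i k → w i * (x k * δ (j k) i) * y i) ⟩
      sum (λ k → sum (λ i → w i * (x k * δ (j k) i) * y i))
        ≡⟨ sum-cong-≗ (λ k → sum-cong-≗ (λ i → shuffle (w i) (x k) (δ (j k) i) (y i))) ⟩
      sum (λ k → sum (λ i → x k * (δ (j k) i * (w i * y i))))
        ≡⟨ sum-cong-≗ (λ k → sym (*-distribˡ-sum (x k) (λ i → δ (j k) i * (w i * y i)))) ⟩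
      sum (λ k → x k * sum (λ i → δ (j k) i * (w i * y i)))
        ≡⟨ sum-cong-≗ (λ k → cong (x k *_) (sum-δ (j k) (λ i → w i * y i))) ⟩
      sum (λ k → x k * (w (j k) * y (j k)))
        ≡⟨ sum-cong-≗ (λ k → reorder (x k) (w (j k)) (y (j k))) ⟩
      sum (λ k → w (j k) * x k * y (j k))
        ≡⟨ sym (Bℤ≡sum (w ∘ j) x (y ∘ j)) ⟩
      Bℤ (w ∘ j) x (y ∘ j)
        ∎
      where
      open ≡-Reasoning
      distrib : ∀ a (g : Fin n → ℤ) b → a * sum g * b ≡ sum (λ k → a * g k * b)
      distrib a g b = trans (cong (_* b) (*-distribˡ-sum a g)) (*-distribʳ-sum b (λ k → a * g k))
      shuffle : ∀ a c d b → a * (c * d) * b ≡ c * (d * (a * b))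
      shuffle = solve-∀
      reorder : ∀ c a b → c * (a * b) ≡ a * c * b
      reorder = solve-∀

    Bℤ-pushforward : Injective _≡_ _≡_ j → ∀ w x y →
                     Bℤ w (pushforward j x) (pushforward j y) ≡ Bℤ (w ∘ j) x y
    Bℤ-pushforward j-inj w x y =
      trans (Bℤ-pushforwardˡ w x (pushforward j y)) (Bℤ-congʳ (w ∘ j) x (pushforward-∘ j-inj y))

  Bℤ-zeroˡ : ∀ {n} (w x y : Fin n → ℤ) → (∀ i → x i ≡ 0ℤ) → Bℤ w x y ≡ 0ℤ
  Bℤ-zeroˡ {n} w x y x≡0 =
    trans (Bℤ≡sum w x y)
      (trans (sum-cong-≗ (λ i → trans (cong (λ t → w i * t * y i) (x≡0 i)) (vanish (w i) (y i))))
             (sum-replicate-zero n))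
    where
    vanish : ∀ a c → a * 0ℤ * c ≡ 0ℤ
    vanish = solve-∀

module PrefixSums where
  open DiagonalForms
  open import Data.Integer.Base using (_+_; _*_)

  prefixSum-zero : ∀ {n} (f : Fin n → ℕ) → prefixSum f 0 ≡ 0
  prefixSum-zero {zero} f = refl
  prefixSum-zero {suc n} f = refl

  prefixSum-suc : ∀ {n} (f : Fin n → ℕ) k → prefixSum f (suc (toℕ k)) ≡ prefixSum f (toℕ k) ℕ.+ f k
  prefixSum-suc f zero = trans (cong (f zero ℕ.+_) (prefixSum-zero (f ∘ suc))) (ℕ.+-identityʳ (f zero))
  prefixSum-suc f (suc k) =
    trans (cong (f zero ℕ.+_) (prefixSum-suc (f ∘ suc) k)) (sym (ℕ.+-assoc (f zero) _ (f (suc k))))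

  prefixSum-mono : ∀ {n} (f : Fin n → ℕ) {l l′} → l ℕ.≤ l′ → prefixSum f l ℕ.≤ prefixSum f l′
  prefixSum-mono {zero} f _ = z≤n
  prefixSum-mono {suc n} f {zero} _ = z≤n
  prefixSum-mono {suc n} f (s≤s l≤l′) = ℕ.+-monoʳ-≤ (f zero) (prefixSum-mono (f ∘ suc) l≤l′)

  prefixSum≡0 : ∀ {n} (f : Fin n → ℕ) {l} → prefixSum f l ≡ 0 → ∀ k → toℕ k ℕ.< l → f k ≡ 0
  prefixSum≡0 f {suc l} Σ≡0 zero _ = ℕ.m+n≡0⇒m≡0 (f zero) Σ≡0
  prefixSum≡0 f {suc l} Σ≡0 (suc k) (s≤s k<l) =
    prefixSum≡0 (f ∘ suc) (ℕ.m+n≡0⇒n≡0 (f zero) Σ≡0) k k<l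

  𝟙[_<_] : ∀ {n} → Fin n → ℕ → ℤ
  𝟙[ zero  < zero  ] = 0ℤ
  𝟙[ zero  < suc _ ] = 1ℤ
  𝟙[ suc _ < zero  ] = 0ℤ
  𝟙[ suc k < suc l ] = 𝟙[ k < l ]

  𝟙-< : ∀ {n} (k : Fin n) {l} → toℕ k ℕ.< l → 𝟙[ k < l ] ≡ 1ℤ
  𝟙-< zero    (s≤s _)   = refl
  𝟙-< (suc k) (s≤s k<l) = 𝟙-< k k<l

  𝟙-≥ : ∀ {n} (k : Fin n) {l} → l ℕ.≤ toℕ k → 𝟙[ k < l ] ≡ 0ℤ
  𝟙-≥ zero    z≤n       = refl
  𝟙-≥ (suc k) z≤n       = refl
  𝟙-≥ (suc k) (s≤s l≤k) = 𝟙-≥ k l≤k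

  Bℤ-𝟙-α : ∀ {n} (f : Fin n → ℕ) l → Bℤ (λ k → + f k) (λ k → 𝟙[ k < l ]) α ≡ + prefixSum f l
  Bℤ-𝟙-α {zero} f l = refl
  Bℤ-𝟙-α {suc n} f zero = Bℤ-zeroˡ (λ k → + f k) (λ k → 𝟙[ k < 0 ]) α (λ k → 𝟙-≥ k z≤n)
  Bℤ-𝟙-α {suc n} f (suc l) =
    trans (cong₂ _+_ (unit (+ f zero)) (Bℤ-𝟙-α (f ∘ suc) l)) (sym (ℤ.pos-+ (f zero) _))
    where
    unit : ∀ x → x * 1ℤ * 1ℤ ≡ x
    unit = solve-∀

module Construction {m : ℕ} (A : Fin (suc m) → ℕ) where
  open FiniteSums
  open DiagonalForms
  open PrefixSums
  open import Data.Fin.Base using (_<_)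
  open import Data.Integer.Base using (_+_; _*_)

  Aℤ : Fin (suc m) → ℤ
  Aℤ k = + A k

  S : Fin m → ℕ
  S h = prefixSum A (suc (toℕ h))

  b : Fin m → ℕ
  b h = A (suc h) ℕ.* prefixSum A (toℕ h ℕ.+ 1) ℕ.* prefixSum A (toℕ h ℕ.+ 2)

  b-as-S : ∀ h → b h ≡ A (suc h) ℕ.* S h ℕ.* (S h ℕ.+ A (suc h))
  b-as-S h = cong₂ (λ s s′ → A (suc h) ℕ.* s ℕ.* s′)
           (cong (prefixSum A) (ℕ.+-comm (toℕ h) 1))
           (trans (cong (prefixSum A) (ℕ.+-comm (toℕ h) 2)) (prefixSum-suc A (suc h)))

  𝟙≤ : Fin m → Fin (suc m) → ℤ
  𝟙≤ h k = 𝟙[ k < suc (toℕ h) ]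

  u : Fin m → Fin (suc m) → ℤ
  u h k = - Aℤ (suc h) * 𝟙≤ h k + + S h * δ (suc h) k

  u-≤ : ∀ h k → toℕ k ℕ.≤ toℕ h → u h k ≡ - Aℤ (suc h)
  u-≤ h k k≤h = trans (cong₂ (λ i d → - Aℤ (suc h) * i + + S h * d)
                        (𝟙-< k (s≤s k≤h))
                        (δ-≢ {i = suc h} {k} (λ { refl → ℕ.<-irrefl refl (s≤s k≤h) })))
                  (ring (Aℤ (suc h)) (+ S h))
    where
    ring : ∀ x s → - x * 1ℤ + s * 0ℤ ≡ - x
    ring = solve-∀

  u-suc : ∀ h → u h (suc h) ≡ + S h
  u-suc h = trans (cong₂ (λ i d → - Aℤ (suc h) * i + + S h * d) (𝟙-≥ h ℕ.≤-refl) (δ-refl (suc h)))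
              (ring (Aℤ (suc h)) (+ S h))
    where
    ring : ∀ x s → - x * 0ℤ + s * 1ℤ ≡ s
    ring = solve-∀

  u-> : ∀ h k → suc (toℕ h) ℕ.< toℕ k → u h k ≡ 0ℤ
  u-> h k h<k = trans (cong₂ (λ i d → - Aℤ (suc h) * i + + S h * d)
                        (𝟙-≥ k (ℕ.<⇒≤ h<k))
                        (δ-≢ {i = suc h} {k} (λ { refl → ℕ.<-irrefl refl h<k })))
                  (ring (Aℤ (suc h)) (+ S h))
    where
    ring : ∀ x s → - x * 0ℤ + s * 0ℤ ≡ 0ℤ
    ring = solve-∀

  Bℤ-u : ∀ h y → Bℤ Aℤ (u h) y ≡ - Aℤ (suc h) * Bℤ Aℤ (𝟙≤ h) y + + S h * (Aℤ (suc h) * y (suc h))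
  Bℤ-u h y = trans (Bℤ-linearˡ Aℤ (- Aℤ (suc h)) (+ S h) (𝟙≤ h) (δ (suc h)) y)
                   (cong (λ t → - Aℤ (suc h) * Bℤ Aℤ (𝟙≤ h) y + + S h * t) (Bℤ-δˡ Aℤ (suc h) y))

  u-α : ∀ h → Bℤ Aℤ (u h) α ≡ 0ℤ
  u-α h = begin
    Bℤ Aℤ (u h) α                                  ≡⟨ Bℤ-u h α ⟩
    - X * Bℤ Aℤ (𝟙≤ h) α + + S h * (X * 1ℤ)        ≡⟨ cong (λ t → - X * t + + S h * (X * 1ℤ)) (Bℤ-𝟙-α A _) ⟩
    - X * + S h + + S h * (X * 1ℤ)                 ≡⟨ cancel X (+ S h) ⟩
    0ℤ                                             ∎
    where
    open ≡-Reasoning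
    X = Aℤ (suc h)
    cancel : ∀ x s → - x * s + s * (x * 1ℤ) ≡ 0ℤ
    cancel = solve-∀

  u-orthogonal : ∀ {h h′} → toℕ h ℕ.< toℕ h′ → Bℤ Aℤ (u h) (u h′) ≡ 0ℤ
  u-orthogonal {h} {h′} h<h′ =
    trans (Bℤ-constOnSupport Aℤ (u h) (u h′) (- Aℤ (suc h′)) support)
          (trans (cong (- Aℤ (suc h′) *_) (u-α h)) (ℤ.*-zeroʳ (- Aℤ (suc h′))))
    where
    support : ∀ k → u h k ≡ 0ℤ ⊎ u h′ k ≡ - Aℤ (suc h′)
    support k with ℕ.≤-<-connex (toℕ k) (suc (toℕ h))
    ... | inj₁ k≤1+h = inj₂ (u-≤ h′ k (ℕ.≤-trans k≤1+h h<h′))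
    ... | inj₂ 1+h<k = inj₁ (u-> h k 1+h<k)

  u-norm : ∀ h → Bℤ Aℤ (u h) (u h) ≡ + b h
  u-norm h = begin
    Bℤ Aℤ (u h) (u h)
      ≡⟨ Bℤ-u h (u h) ⟩
    - X * Bℤ Aℤ (𝟙≤ h) (u h) + + S h * (X * u h (suc h))
      ≡⟨ cong₂ (λ t t′ → - X * t + + S h * (X * t′)) 𝟙≤·u (u-suc h) ⟩
    - X * (- X * + S h) + + S h * (X * + S h)
      ≡⟨ ring X (+ S h) ⟩
    X * + S h * (+ S h + X)
      ≡⟨ sym (cong₂ _*_ (ℤ.pos-* (A (suc h)) (S h)) (ℤ.pos-+ (S h) (A (suc h)))) ⟩
    + (A (suc h) ℕ.* S h) * + (S h ℕ.+ A (suc h))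
      ≡⟨ sym (ℤ.pos-* (A (suc h) ℕ.* S h) (S h ℕ.+ A (suc h))) ⟩
    + (A (suc h) ℕ.* S h ℕ.* (S h ℕ.+ A (suc h)))
      ≡⟨ cong +_ (sym (b-as-S h)) ⟩
    + b h
      ∎
    where
    open ≡-Reasoning
    X = Aℤ (suc h)
    support : ∀ k → 𝟙≤ h k ≡ 0ℤ ⊎ u h k ≡ - X
    support k with ℕ.≤-<-connex (toℕ k) (toℕ h)
    ... | inj₁ k≤h = inj₂ (u-≤ h k k≤h)
    ... | inj₂ h<k = inj₁ (𝟙-≥ k h<k)
    𝟙≤·u : Bℤ Aℤ (𝟙≤ h) (u h) ≡ - X * + S h
    𝟙≤·u = trans (Bℤ-constOnSupport Aℤ (𝟙≤ h) (u h) (- X) support) (cong (- X *_) (Bℤ-𝟙-α A _))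
    ring : ∀ x s → - x * (- x * s) + s * (x * s) ≡ x * s * (s + x)
    ring = solve-∀

  -- Abstracting S h lets S-cases split on it without unfolding the goal.
  wₛ : Fin m → ℕ → Fin (suc m) → ℤ
  wₛ h zero    = δ (inject₁ h)
  wₛ h (suc _) = u h

  pivotₛ : Fin m → ℕ → Fin (suc m)
  pivotₛ h zero    = inject₁ h
  pivotₛ h (suc _) = suc h

  w : Fin m → Fin (suc m) → ℤ
  w h = wₛ h (S h)

  pivot : Fin m → Fin (suc m)
  pivot h = pivotₛ h (S h)

  S-cases : ∀ h (P : ℕ → Set) → (S h ≡ 0 → P 0) → (∀ {s} → S h ≡ suc s → P (suc s)) → P (S h)
  S-cases h P null regular with S h
  ... | zero  = null refl
  ... | suc _ = regular refl

  S-mono : ∀ {k h} → toℕ k ℕ.≤ toℕ h → S h ≡ 0 → S k ≡ 0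
  S-mono {k} k≤h Sh≡0 = ℕ.n≤0⇒n≡0 (subst (S k ℕ.≤_) Sh≡0 (prefixSum-mono A (s≤s k≤h)))

  Bℤ-δ-null : ∀ h → S h ≡ 0 → ∀ y → Bℤ Aℤ (δ (inject₁ h)) y ≡ 0ℤ
  Bℤ-δ-null h Sh≡0 y = trans (Bℤ-δˡ Aℤ (inject₁ h) y) (cong (λ a → + a * y (inject₁ h)) A≡0)
    where
    A≡0 : A (inject₁ h) ≡ 0
    A≡0 = prefixSum≡0 A Sh≡0 (inject₁ h) (s≤s (ℕ.≤-reflexive (toℕ-inject₁ h)))

  w-α : ∀ h → Bℤ Aℤ (w h) α ≡ 0ℤ
  w-α h = S-cases h (λ s → Bℤ Aℤ (wₛ h s) α ≡ 0ℤ) (λ Sh≡0 → Bℤ-δ-null h Sh≡0 α) (λ _ → u-α h)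

  w-⊥-constant : ∀ h {y} r → (∀ k → y k ≡ r) → Bℤ Aℤ (w h) y ≡ 0ℤ
  w-⊥-constant h {y} r y≡r = trans (Bℤ-constOnSupport Aℤ (w h) y r (inj₂ ∘ y≡r))
                                (trans (cong (r *_) (w-α h)) (ℤ.*-zeroʳ r))

  w-norm : ∀ h → Bℤ Aℤ (w h) (w h) ≡ + b h
  w-norm h = S-cases h (λ s → Bℤ Aℤ (wₛ h s) (wₛ h s) ≡ + b h) null (λ _ → u-norm h)
    where
    null : S h ≡ 0 → Bℤ Aℤ (δ (inject₁ h)) (δ (inject₁ h)) ≡ + b h
    null Sh≡0 = trans (Bℤ-δ-null h Sh≡0 (δ (inject₁ h))) (cong +_ (sym b≡0))
      where
      b≡0 : b h ≡ 0
      b≡0 = trans (b-as-S h) (trans (cong (λ s → A (suc h) ℕ.* s ℕ.* (s ℕ.+ A (suc h))) Sh≡0)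
                                (cong (ℕ._* A (suc h)) (ℕ.*-zeroʳ (A (suc h)))))

  w-orthogonal : ∀ {h h′} → h ≢ h′ → Bℤ Aℤ (w h) (w h′) ≡ 0ℤ
  w-orthogonal {h} {h′} h≢h′ =
    S-cases h (λ s → Bℤ Aℤ (wₛ h s) (w h′) ≡ 0ℤ)
      (λ Sh≡0 → Bℤ-δ-null h Sh≡0 (w h′))
      λ _ → S-cases h′ (λ s → Bℤ Aℤ (u h) (wₛ h′ s) ≡ 0ℤ)
              (λ Sh′≡0 → trans (Bℤ-sym Aℤ (u h) (δ (inject₁ h′))) (Bℤ-δ-null h′ Sh′≡0 (u h)))
              λ _ → by-trichotomy (<-cmp h h′)
    where
    by-trichotomy : Tri (h < h′) (h ≡ h′) (h′ < h) → Bℤ Aℤ (u h) (u h′) ≡ 0ℤ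
    by-trichotomy (tri< h<h′ _ _) = u-orthogonal h<h′
    by-trichotomy (tri≈ _ h≡h′ _) = contradiction h≡h′ h≢h′
    by-trichotomy (tri> _ _ h′<h) = trans (Bℤ-sym Aℤ (u h) (u h′)) (u-orthogonal h′<h)

  w-vanishes-beyond : ∀ h k → suc (toℕ h) ℕ.< toℕ k → w h k ≡ 0ℤ
  w-vanishes-beyond h k h<k = S-cases h (λ s → wₛ h s k ≡ 0ℤ)
    (λ _ → δ-≢ {i = inject₁ h} {k}
             (λ { refl → ℕ.<-irrefl (sym (toℕ-inject₁ h)) (ℕ.<-trans (ℕ.n<1+n _) h<k) }))
    (λ _ → u-> h k h<k)

  w-pivot≢0 : ∀ h → w h (pivot h) ≢ 0ℤ
  w-pivot≢0 h = S-cases h (λ s → wₛ h s (pivotₛ h s) ≢ 0ℤ)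
    (λ _ δ≡0 → contradiction (trans (sym (δ-refl (inject₁ h))) δ≡0) λ ())
    (λ Sh≡1+s u≡0 → contradiction (trans (sym (trans (u-suc h) (cong +_ Sh≡1+s))) u≡0) λ ())

  w-below-pivot : ∀ {k h} → k < h → w k (pivot h) ≡ 0ℤ
  w-below-pivot {k} {h} k<h = S-cases h (λ s → w k (pivotₛ h s) ≡ 0ℤ)
    (λ Sh≡0 → S-cases k (λ s → wₛ k s (inject₁ h) ≡ 0ℤ)
      (λ _ → δ-≢ (λ k≡h → ℕ.<-irrefl (trans (sym (toℕ-inject₁ k)) (trans (cong toℕ k≡h) (toℕ-inject₁ h)))
                                       k<h))
      (λ Sk≡1+s → contradiction (trans (sym Sk≡1+s) (S-mono (ℕ.<⇒≤ k<h) Sh≡0)) λ ()))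
    (λ _ → w-vanishes-beyond k (suc h) (s≤s k<h))

open PAdic using (Bₚ-ι; triangular⇒independent)
open DiagonalForms using (Bℤ-sym; pushforward; pushforward-∘; Bℤ-pushforwardˡ; Bℤ-pushforward)

open import Data.Nat using (ℕ; suc; _+_; _*_)
open import Data.Nat.Primality using (Prime)
open import Data.Fin using (Fin; suc; toℕ)
open import Data.Integer using (ℤ; +_)
open import Function.Definitions using (Injective)
open import Relation.Binary.PropositionalEquality using (_≡_)

lemma4p6 : (a : Fin 10 → ℕ) (β : Fin 10 → ℤ) →
    Bℤ (λ i → + a i) α β ≡ + 1 →
    (m : ℕ) (j : Fin (suc m) → Fin 10) → Injective _≡_ _≡_ j →
    (∀ h k → β (j h) ≡ β (j k)) →
    (p : ℕ) → Prime p →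
    DiagSublattice p (λ i → + a i) β m
      (λ h → + (a (j (suc h))
                * prefixSum (λ k → a (j k)) (toℕ h + 1)
                * prefixSum (λ k → a (j k)) (toℕ h + 2)))
lemma4p6 a β _ m j j-inj β∘j-const p p-prime = record
  { v        = λ h i → ι p (v h i)
  ; inL      = λ h → record
      { orthα = Bₚ-ι a′ α (v h) (v-⊥ h α 1ℤ (λ _ → refl))
      ; orthβ = Bₚ-ι a′ β (v h) (v-⊥ h β (β (j zero)) (λ k → β∘j-const k zero)) }
  ; linIndep = triangular⇒independent p-prime v (j ∘ pivot)
                 (λ h → w-pivot≢0 h ∘ trans (sym (pushforward-∘ j j-inj (w h) (pivot h))))
                 (λ {k} {h} k<h → trans (pushforward-∘ j j-inj (w k) (pivot h)) (w-below-pivot k<h))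
  ; gramDiag = λ h → Bₚ-ι a′ (v h) (v h)
                       (trans (Bℤ-pushforward j j-inj a′ (w h) (w h)) (w-norm h))
  ; gramOff  = λ h k h≢k → Bₚ-ι a′ (v h) (v k)
                             (trans (Bℤ-pushforward j j-inj a′ (w h) (w k)) (w-orthogonal h≢k))
  }
  where
  open Construction (λ k → a (j k))
  a′ : Fin 10 → ℤ
  a′ i = + a i
  v : Fin m → Fin 10 → ℤ
  v h = pushforward j (w h)
  v-⊥ : ∀ h y r → (∀ k → y (j k) ≡ r) → Bℤ a′ y (v h) ≡ 0ℤ
  v-⊥ h y r y∘j≡r =
    trans (Bℤ-sym a′ y (v h)) (trans (Bℤ-pushforwardˡ j a′ (w h) y) (w-⊥-constant h r y∘j≡r))
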